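{- Let $d\ge 8$ and let $P_d$ be the graph obtained from $K_{d+1}$ by deleting the edges of three pairwise vertex-disjoint paths of length 2 and then deleting the edges of a maximum matching on the $d-8$ vertices not on these paths (so exactly three vertices of $P_d$, the middle vertices of the deleted paths, have degree $d-2$). Let $G_d$ be any graph obtained from a copy of $K_{d-3}$ by adding pairwise vertex-disjoint copies of $P_d$, where for each copy one edge is added from each of its three vertices of degree $d-2$ to some vertex of the $K_{d-3}$, there are no edges between distinct copies, and enough copies are added so that every vertex of the $K_{d-3}$ has degree at least $d-1$. Then $G_d$ has minimum degree $d-1$ and has no immersion of $K_d$.
   Context: A graph $H$ is immersed in a graph $G$ if there is an injection $\phi:V(H)\to V(G)$ and an assignment to each edge $uv\in E(H)$ of a path in $G$ between $\phi(u)$ and $\phi(v)$ with paths of distinct edges pairwise edge-disjoint. -}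

module Defs where

open import Data.Nat using (ℕ; zero; suc; _+_; _*_; _∸_; _≤_; _%_; _≡ᵇ_; _≤ᵇ_)
open import Data.Bool using (Bool; true; false; _∧_; _∨_; not; if_then_else_; T)
import Data.Fin as Fin
open import Data.Fin using (Fin; toℕ; splitAt; remQuot; _↑ˡ_; _<_)
open import Data.Maybe using (Maybe; just; nothing)
open import Data.List using (List; []; _∷_; allFin; map; head; last)
open import Data.Nat.ListAction using (sum)
open import Data.List.Membership.Propositional using (_∈_)
open import Data.List.Relation.Unary.Linked using (Linked)
open import Data.List.Relation.Unary.Unique.Propositional using (Unique)
open import Data.Product using (_×_; _,_; ∃; Σ)
open import Data.Sum using (_⊎_; inj₁; inj₂)
open import Relation.Binary.PropositionalEquality using (_≡_)
open import Relation.Nullary using (¬_)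
open import Function.Definitions using (Injective)

Adj : ℕ → Set
Adj n = Fin n → Fin n → Bool

degree : ∀ {n} → Adj n → Fin n → ℕ
degree {n} A v = sum (map (λ w → if A v w then 1 else 0) (allFin n))

MinDegree : ∀ {n} → Adj n → ℕ → Set
MinDegree A k = (∀ v → k ≤ degree A v) × ∃ (λ v → degree A v ≡ k)

IsPath : ∀ {n} → Adj n → Fin n → Fin n → List (Fin n) → Set
IsPath A u v vs =
  (head vs ≡ just u) × (last vs ≡ just v) ×
  Linked (λ x y → T (A x y)) vs × Unique vs

edgesOf : ∀ {n} → List (Fin n) → List (Fin n × Fin n)
edgesOf []             = []
edgesOf (x ∷ [])       = []
edgesOf (x ∷ y ∷ rest) = (x , y) ∷ edgesOf (y ∷ rest)

SameEdge : ∀ {n} → Fin n × Fin n → Fin n × Fin n → Set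
SameEdge (a , b) (c , d) = (a ≡ c × b ≡ d) ⊎ (a ≡ d × b ≡ c)

EdgeDisjoint : ∀ {n} → List (Fin n) → List (Fin n) → Set
EdgeDisjoint p q =
  ∀ e f → e ∈ edgesOf p → f ∈ edgesOf q → ¬ SameEdge e f

record KImmersion (d : ℕ) {n : ℕ} (A : Adj n) : Set where
  field
    φ        : Fin d → Fin n
    φ-inj    : Injective _≡_ _≡_ φ
    path     : (i j : Fin d) → i < j → List (Fin n)
    path-ok  : ∀ i j (i<j : i < j) → IsPath A (φ i) (φ j) (path i j i<j)
    disjoint : ∀ i j i' j' (i<j : i < j) (i'<j' : i' < j') →
               ¬ (i ≡ i' × j ≡ j') →
               EdgeDisjoint (path i j i<j) (path i' j' i'<j')

-- The graph P_d on vertices 0,…,d (labelled by naturals).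
-- Deleted 2-paths: 0-1-2, 3-4-5, 6-7-8 (middle vertices 1, 4, 7).
-- Deleted maximum matching on 9,…,d: {9,10}, {11,12}, … .

pathEdge : ℕ → ℕ → Bool
pathEdge a b =
     ((a ≡ᵇ 0) ∧ (b ≡ᵇ 1)) ∨ ((a ≡ᵇ 1) ∧ (b ≡ᵇ 2))
  ∨ ((a ≡ᵇ 3) ∧ (b ≡ᵇ 4)) ∨ ((a ≡ᵇ 4) ∧ (b ≡ᵇ 5))
  ∨ ((a ≡ᵇ 6) ∧ (b ≡ᵇ 7)) ∨ ((a ≡ᵇ 7) ∧ (b ≡ᵇ 8))

matchEdge : ℕ → ℕ → Bool
matchEdge a b = (9 ≤ᵇ a) ∧ (((a ∸ 9) % 2) ≡ᵇ 0) ∧ (b ≡ᵇ suc a)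

deletedP : ℕ → ℕ → Bool
deletedP a b = pathEdge a b ∨ pathEdge b a ∨ matchEdge a b ∨ matchEdge b a

adjP : ∀ {d} → Fin (suc d) → Fin (suc d) → Bool
adjP x y = not (toℕ x ≡ᵇ toℕ y) ∧ not (deletedP (toℕ x) (toℕ y))

middleIs : ∀ {d} → Fin 3 → Fin (suc d) → Bool
middleIs Fin.zero                     x = toℕ x ≡ᵇ 1
middleIs (Fin.suc Fin.zero)           x = toℕ x ≡ᵇ 4
middleIs (Fin.suc (Fin.suc Fin.zero)) x = toℕ x ≡ᵇ 7

-- The graph G_d: a K_{d-3} on the first d ∸ 3 vertices, followed by m
-- copies of P_d (copy j, local vertex l).  att j i is the vertex of the
-- K_{d-3} to which the i-th middle vertex of copy j is joined.

Gsize : ℕ → ℕ → ℕ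
Gsize d m = (d ∸ 3) + m * suc d

data VKind (d m : ℕ) : Set where
  kv : Fin (d ∸ 3) → VKind d m
  cv : Fin m → Fin (suc d) → VKind d m

kind : ∀ d m → Fin (Gsize d m) → VKind d m
kind d m x with splitAt (d ∸ 3) x
... | inj₁ k = kv k
... | inj₂ r with remQuot {m} (suc d) r
...   | (j , l) = cv j l

finEq : ∀ {k} → Fin k → Fin k → Bool
finEq a b = toℕ a ≡ᵇ toℕ b

attached : ∀ {d m} → (Fin m → Fin 3 → Fin (d ∸ 3)) →
           Fin (d ∸ 3) → Fin m → Fin (suc d) → Bool
attached att k j l =
     (middleIs Fin.zero l ∧ finEq (att j Fin.zero) k)
  ∨ (middleIs (Fin.suc Fin.zero) l ∧ finEq (att j (Fin.suc Fin.zero)) k)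
  ∨ (middleIs (Fin.suc (Fin.suc Fin.zero)) l
       ∧ finEq (att j (Fin.suc (Fin.suc Fin.zero))) k)

adjKind : ∀ {d m} → (Fin m → Fin 3 → Fin (d ∸ 3)) → VKind d m → VKind d m → Bool
adjKind att (kv k)   (kv k')   = not (finEq k k')
adjKind att (kv k)   (cv j l)  = attached att k j l
adjKind att (cv j l) (kv k)    = attached att k j l
adjKind att (cv j l) (cv j' l') = finEq j j' ∧ adjP l l'

Gd : (d m : ℕ) → (Fin m → Fin 3 → Fin (d ∸ 3)) → Adj (Gsize d m)
Gd d m att x y = adjKind att (kind d m x) (kind d m y)

kVertex : ∀ d m → Fin (d ∸ 3) → Fin (Gsize d m)
kVertex d m k = k ↑ˡ (m * suc d)

module Submission where

-- Degrees: a vertex of P_d misses at most two others (a middle vertex three, but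
-- it has its attachment edge), and the corner 0 of a copy has degree exactly d - 1.
-- Immersion: a branch vertex has d - 1 edge-disjoint links, hence d - 1 distinct
-- neighbours, and lies inside no other link when its degree is at most d.  A copy
-- is cut off by three edges, so (d - 1 ≥ 4) the branch vertices lie all in one copy
-- or all in the clique K_(d-3); the latter is too small.  In a copy at most one of
-- the d + 1 labels is free, a branch vertex at a middle label must use its
-- attachment edge, so its link leaves and re-enters the copy through two cut
-- edges, and comparing the middle labels gives two such excursions or two free
-- labels.

open import Defs
open import Data.Nat using (ℕ; zero; suc; _+_; _*_; _%_; _∸_; _≤_; _<_; z≤n; s≤s; s≤s⁻¹; _≡ᵇ_; _≤ᵇ_)
open import Data.Nat.Properties
  using (+-suc; +-comm; 1+n≰n; m+n≮n; ≡ᵇ⇒≡; +-cancelˡ-≤; +-monoˡ-≤; ≤-trans; ≤-antisym)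
open import Data.Nat.DivMod using (%-distribˡ-+)
open import Data.Nat.ListAction using (sum)
open import Data.Bool using (Bool; true; false; T; _∧_; _∨_; not; if_then_else_)
open import Data.Bool.Properties using (T?; T-∨; T-∧)
import Data.Bool.Properties as Bool
open import Data.Fin using (Fin; toℕ; #_; splitAt; join; combine; _↑ˡ_; _↑ʳ_; punchIn; punchOut)
import Data.Fin as F
open import Data.Fin.Properties
  using (_≟_; any?; <-cmp; <⇒≢; pigeonhole; injective⇒≤; toℕ-injective; punchIn-injective; punchInᵢ≢i;
         punchIn-punchOut; splitAt-↑ˡ; splitAt-↑ʳ; remQuot-combine; combine-remQuot; join-splitAt)
open import Data.Maybe using (just)
open import Data.List using (List; []; _∷_; _++_; [_]; length; filter; map; allFin; head; last)
open import Data.List.Properties using (length-++; length-map; length-tabulate)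
open import Data.List.Membership.Propositional using (_∈_)
open import Data.List.Membership.Propositional.Properties
  using (∈-∃++; ∈-++⁻; ∈-++⁺ˡ; ∈-++⁺ʳ; ∈-allFin; ∈-map⁻; ∈-filter⁺; ∈-filter⁻)
open import Data.List.Relation.Unary.Any using (here; there)
open import Data.List.Relation.Unary.All using (All; []; _∷_)
open import Data.List.Relation.Unary.All.Properties using (All¬⇒¬Any; ¬Any⇒All¬)
open import Data.List.Relation.Unary.AllPairs using ([]; _∷_)
open import Data.List.Relation.Unary.Linked using (Linked; _∷_)
open import Data.List.Relation.Unary.Unique.Propositional using (Unique)
open import Data.List.Relation.Unary.Unique.Propositional.Properties using (++⁺; map⁺; filter⁺; allFin⁺)
open import Data.Product using (_×_; _,_; ∃; ∃₂; proj₁; proj₂)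
open import Data.Sum using (_⊎_; inj₁; inj₂; swap)
open import Data.Empty using (⊥; ⊥-elim)
open import Function.Bundles using (Equivalence)
open import Relation.Binary.Definitions using (tri<; tri≈; tri>)
open import Relation.Binary.PropositionalEquality hiding ([_])
open import Relation.Nullary using (¬_; yes; no; Dec)
open import Relation.Nullary.Decidable using (_×-dec_; _⊎-dec_)

true≢false : ¬ true ≡ false
true≢false ()

T⇒≡true : ∀ {b} → T b → b ≡ true
T⇒≡true {true} _ = refl

T-not⇒≡false : ∀ {b} → T (not b) → b ≡ false
T-not⇒≡false {false} _ = refl

T-∨⁻ : ∀ x {y} → T (x ∨ y) → T x ⊎ T y
T-∨⁻ x = Equivalence.to (T-∨ {x})

T-∧⁻ : ∀ x {y} → T (x ∧ y) → T x × T y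
T-∧⁻ x = Equivalence.to (T-∧ {x})

T-≡ᵇ-pair : ∀ {a b} m n → T ((a ≡ᵇ m) ∧ (b ≡ᵇ n)) → a ≡ m × b ≡ n
T-≡ᵇ-pair {a} {b} m n t = let (p , q) = T-∧⁻ (a ≡ᵇ m) t in ≡ᵇ⇒≡ a m p , ≡ᵇ⇒≡ b n q

≡ᵇ-refl : ∀ n → (n ≡ᵇ n) ≡ true
≡ᵇ-refl zero    = refl
≡ᵇ-refl (suc n) = ≡ᵇ-refl n

≡ᵇ-sym : ∀ a b → (a ≡ᵇ b) ≡ (b ≡ᵇ a)
≡ᵇ-sym zero    zero    = refl
≡ᵇ-sym zero    (suc b) = refl
≡ᵇ-sym (suc a) zero    = refl
≡ᵇ-sym (suc a) (suc b) = ≡ᵇ-sym a b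

complement-bound : ∀ {a b c n} → b + a ≡ c + n → b ≤ c → n ≤ a
complement-bound {a} {b} {c} {n} eq b≤c = +-cancelˡ-≤ c n a (subst (_≤ c + a) eq (+-monoˡ-≤ a b≤c))

inhabited-or-empty : ∀ n → Fin n ⊎ ¬ Fin n
inhabited-or-empty zero    = inj₂ (λ ())
inhabited-or-empty (suc n) = inj₁ F.zero

unique⊆⇒length≤ : ∀ {a} {X : Set a} (xs ys : List X) → Unique xs →
                  (∀ {x} → x ∈ xs → x ∈ ys) → length xs ≤ length ys
unique⊆⇒length≤ []       ys _          _   = z≤n
unique⊆⇒length≤ (x ∷ xs) ys (x∉ ∷ uxs) xs⊆ys with ∈-∃++ (xs⊆ys (here refl))
... | us , vs , refl =
  subst (suc (length xs) ≤_) (sym length-removed) (s≤s (unique⊆⇒length≤ xs (us ++ vs) uxs xs⊆rest))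
  where
  xs⊆rest : ∀ {y} → y ∈ xs → y ∈ us ++ vs
  xs⊆rest y∈ with ∈-++⁻ us (xs⊆ys (there y∈))
  ... | inj₁ p         = ∈-++⁺ˡ p
  ... | inj₂ (here refl) = ⊥-elim (All¬⇒¬Any x∉ y∈)
  ... | inj₂ (there p) = ∈-++⁺ʳ us p
  length-removed : length (us ++ [ x ] ++ vs) ≡ suc (length (us ++ vs))
  length-removed = begin
    length (us ++ [ x ] ++ vs)      ≡⟨ length-++ us ⟩
    length us + suc (length vs)     ≡⟨ +-suc (length us) (length vs) ⟩
    suc (length us + length vs)     ≡⟨ cong suc (sym (length-++ us)) ⟩
    suc (length (us ++ vs))         ∎
    where open ≡-Reasoning

map-unique : ∀ {a b} {X : Set a} {Y : Set b} (f : X → Y) (xs : List X) → Unique xs →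
             (∀ {x y} → x ∈ xs → y ∈ xs → f x ≡ f y → x ≡ y) → Unique (map f xs)
map-unique f []       _          _   = []
map-unique f (x ∷ xs) (x∉ ∷ uxs) inj =
  fx∉ xs x∉ (λ y∈ → inj (here refl) (there y∈)) ∷ map-unique f xs uxs (λ p q → inj (there p) (there q))
  where
  fx∉ : ∀ ys → All (λ z → ¬ x ≡ z) ys → (∀ {y} → y ∈ ys → f x ≡ f y → x ≡ y) →
        All (λ z → ¬ f x ≡ z) (map f ys)
  fx∉ []       []         _   = []
  fx∉ (y ∷ ys) (x≢y ∷ ne) inj' = (λ eq → x≢y (inj' (here refl) eq)) ∷ fx∉ ys ne (λ p → inj' (there p))

unique⇒length≤ : ∀ {k} (xs : List (Fin k)) → Unique xs → length xs ≤ k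
unique⇒length≤ {k} xs u =
  subst (length xs ≤_) (length-tabulate {n = k} (λ z → z))
        (unique⊆⇒length≤ xs (allFin k) u (λ {x} _ → ∈-allFin x))

avoiding⇒length≤ : ∀ {k} (F xs : List (Fin k)) → Unique F → Unique xs →
                   (∀ {x} → x ∈ F → x ∈ xs → ⊥) → length F + length xs ≤ k
avoiding⇒length≤ F xs uF uxs disj =
  subst (_≤ _) (length-++ F) (unique⇒length≤ (F ++ xs) (++⁺ uF uxs (λ (p , q) → disj p q)))

injection-misses-one : ∀ {k} (f : Fin k → Fin (suc k)) → (∀ {x y} → f x ≡ f y → x ≡ y) →
                       ∀ {a b} → ¬ a ≡ b → (∀ x → ¬ f x ≡ a) → (∀ x → ¬ f x ≡ b) → ⊥
injection-misses-one {k} f inj {a} {b} a≢b a∉ b∉ =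
  1+n≰n (subst (λ n → 2 + n ≤ suc k) length-image
          (avoiding⇒length≤ (a ∷ b ∷ []) image ((a≢b ∷ []) ∷ [] ∷ []) (map⁺ inj (allFin⁺ k)) missed))
  where
  image : List (Fin (suc k))
  image = map f (allFin k)
  length-image : length image ≡ k
  length-image = trans (length-map f (allFin k)) (length-tabulate {n = k} (λ z → z))
  missed : ∀ {c} → c ∈ a ∷ b ∷ [] → c ∈ image → ⊥
  missed c∈ab c∈ with ∈-map⁻ f c∈
  missed (here refl)         _ | x , _ , eq = a∉ x (sym eq)
  missed (there (here refl)) _ | x , _ , eq = b∉ x (sym eq)

two-pairs-in-Fin3-meet : (t₁ t₂ s₁ s₂ : Fin 3) → ¬ t₁ ≡ t₂ → ¬ s₁ ≡ s₂ →
                         (t₁ ≡ s₁ ⊎ t₁ ≡ s₂) ⊎ (t₂ ≡ s₁ ⊎ t₂ ≡ s₂)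
two-pairs-in-Fin3-meet t₁ t₂ s₁ s₂ t≢ s≢
  with t₁ ≟ s₁ | t₁ ≟ s₂ | t₂ ≟ s₁ | t₂ ≟ s₂
... | yes p | _     | _     | _     = inj₁ (inj₁ p)
... | no _  | yes p | _     | _     = inj₁ (inj₂ p)
... | no _  | no _  | yes p | _     = inj₂ (inj₁ p)
... | no _  | no _  | no _  | yes p = inj₂ (inj₂ p)
... | no a  | no b  | no c  | no d  =
  ⊥-elim (1+n≰n (unique⇒length≤ (t₁ ∷ t₂ ∷ s₁ ∷ s₂ ∷ [])
           ((t≢ ∷ a ∷ b ∷ []) ∷ (c ∷ d ∷ []) ∷ (s≢ ∷ []) ∷ [] ∷ [])))

filter-complement : ∀ {a} {X : Set a} (f : X → Bool) (xs : List X) →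
  length (filter (λ x → T? (not (f x))) xs) + length (filter (λ x → T? (f x)) xs) ≡ length xs
filter-complement f []       = refl
filter-complement f (x ∷ xs) with f x
... | true  = trans (+-suc _ _) (cong suc (filter-complement f xs))
... | false = cong suc (filter-complement f xs)

module _ {n : ℕ} where

  neighbours : Adj n → Fin n → List (Fin n)
  neighbours A v = filter (λ w → T? (A v w)) (allFin n)

  degree≡length-neighbours : ∀ A v → degree A v ≡ length (neighbours A v)
  degree≡length-neighbours A v = count (allFin n)
    where
    count : ∀ xs → sum (map (λ w → if A v w then 1 else 0) xs) ≡ length (filter (λ w → T? (A v w)) xs)
    count []       = refl
    count (x ∷ xs) with A v x
    ... | true  = cong suc (count xs)
    ... | false = count xs

  neighbours-unique : ∀ A v → Unique (neighbours A v)
  neighbours-unique A v = filter⁺ (λ w → T? (A v w)) (allFin⁺ n)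

  neighbours-adjacent : ∀ A v {x} → x ∈ neighbours A v → A v x ≡ true
  neighbours-adjacent A v {x} x∈ = T⇒≡true (proj₂ (∈-filter⁻ (λ w → T? (A v w)) {xs = allFin n} x∈))

  neighbour-list≤degree : ∀ A v (xs : List (Fin n)) → Unique xs → (∀ {x} → x ∈ xs → A v x ≡ true) →
                          length xs ≤ degree A v
  neighbour-list≤degree A v xs uxs adj =
    subst (length xs ≤_) (sym (degree≡length-neighbours A v))
      (unique⊆⇒length≤ xs (neighbours A v) uxs
        (λ {x} x∈ → ∈-filter⁺ (λ w → T? (A v w)) (∈-allFin x) (subst T (sym (adj x∈)) _)))

module _ {n : ℕ} where

  edge-endpoints∈ : ∀ {x y} (vs : List (Fin n)) → (x , y) ∈ edgesOf vs → x ∈ vs × y ∈ vs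
  edge-endpoints∈ (a ∷ b ∷ rest) (here refl) = here refl , there (here refl)
  edge-endpoints∈ (a ∷ b ∷ rest) (there p)   =
    let (x∈ , y∈) = edge-endpoints∈ (b ∷ rest) p in there x∈ , there y∈

  edge-related : ∀ {R : Fin n → Fin n → Set} {x y} (vs : List (Fin n)) → Linked R vs →
                 (x , y) ∈ edgesOf vs → R x y
  edge-related (a ∷ b ∷ rest) (r ∷ _)  (here refl) = r
  edge-related (a ∷ b ∷ rest) (_ ∷ rs) (there p)   = edge-related (b ∷ rest) rs p

  edge-ends-distinct : ∀ {x y} (vs : List (Fin n)) → Unique vs → (x , y) ∈ edgesOf vs → ¬ x ≡ y
  edge-ends-distinct (a ∷ b ∷ rest) ((a≢b ∷ _) ∷ _) (here refl) = a≢b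
  edge-ends-distinct (a ∷ b ∷ rest) (_ ∷ u)         (there p)   = edge-ends-distinct (b ∷ rest) u p

  no-edge-both-ways : ∀ {x y} (vs : List (Fin n)) → Unique vs →
                      (x , y) ∈ edgesOf vs → (y , x) ∈ edgesOf vs → ⊥
  no-edge-both-ways (a ∷ b ∷ rest) u (here refl) (here q) =
    edge-ends-distinct (a ∷ b ∷ rest) u (here refl) (cong proj₁ (sym q))
  no-edge-both-ways (a ∷ b ∷ rest) (a∉ ∷ _) (here refl) (there q) =
    All¬⇒¬Any a∉ (proj₂ (edge-endpoints∈ (b ∷ rest) q))
  no-edge-both-ways (a ∷ b ∷ rest) (a∉ ∷ _) (there p) (here refl) =
    All¬⇒¬Any a∉ (proj₂ (edge-endpoints∈ (b ∷ rest) p))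
  no-edge-both-ways (a ∷ b ∷ rest) (_ ∷ u) (there p) (there q) = no-edge-both-ways (b ∷ rest) u p q

  ∈-of-head : ∀ {a} (vs : List (Fin n)) → head vs ≡ just a → a ∈ vs
  ∈-of-head (x ∷ vs) refl = here refl

  ∈-of-last : ∀ {b} (vs : List (Fin n)) → last vs ≡ just b → b ∈ vs
  ∈-of-last (x ∷ [])     refl = here refl
  ∈-of-last (x ∷ y ∷ vs) l    = there (∈-of-last (y ∷ vs) l)

  first-edge : ∀ {a b} (vs : List (Fin n)) → head vs ≡ just a → last vs ≡ just b → ¬ a ≡ b →
               ∃ λ y → (a , y) ∈ edgesOf vs
  first-edge (x ∷ [])     refl refl a≢b = ⊥-elim (a≢b refl)
  first-edge (x ∷ y ∷ vs) refl _    _   = y , here refl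

  last-edge : ∀ {a b} (vs : List (Fin n)) → head vs ≡ just a → last vs ≡ just b → ¬ a ≡ b →
              ∃ λ y → (y , b) ∈ edgesOf vs
  last-edge (x ∷ [])     refl refl a≢b = ⊥-elim (a≢b refl)
  last-edge (x ∷ y ∷ vs) refl l    _   = final-edge x y vs l
    where
    final-edge : ∀ {b} x y vs → last (x ∷ y ∷ vs) ≡ just b → ∃ λ w → (w , b) ∈ edgesOf (x ∷ y ∷ vs)
    final-edge x y []       refl = x , here refl
    final-edge x y (z ∷ vs) l    = let (w , p) = final-edge y z vs l in w , there p

  interior-edges : ∀ {a b w} (vs : List (Fin n)) → Unique vs → head vs ≡ just a → last vs ≡ just b →
                   w ∈ vs → ¬ a ≡ w → ¬ b ≡ w →
                   ∃₂ λ p q → (p , w) ∈ edgesOf vs × (w , q) ∈ edgesOf vs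
  interior-edges (x ∷ r) _ refl _ (here refl) a≢w _ = ⊥-elim (a≢w refl)
  interior-edges (x ∷ y ∷ []) _ refl refl (there (here refl)) _ b≢w = ⊥-elim (b≢w refl)
  interior-edges (x ∷ y ∷ z ∷ r) _ refl _ (there (here refl)) _ _ = x , z , here refl , there (here refl)
  interior-edges (x ∷ y ∷ r) (_ ∷ (y∉ ∷ u)) refl l (there (there p)) _ b≢w =
    let (p' , q' , e₁ , e₂) = interior-edges (y ∷ r) (y∉ ∷ u) refl l (there p)
                                (λ { refl → All¬⇒¬Any y∉ p }) b≢w
    in p' , q' , there e₁ , there e₂

  Leaving Entering : (Fin n → Bool) → List (Fin n) → Set
  Leaving  f vs = ∃₂ λ x y → (x , y) ∈ edgesOf vs × f x ≡ true × f y ≡ false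
  Entering f vs = ∃₂ λ x y → (x , y) ∈ edgesOf vs × f x ≡ false × f y ≡ true

  exit-edge : (f : Fin n → Bool) → ∀ {a w} (vs : List (Fin n)) → head vs ≡ just a → f a ≡ true →
              w ∈ vs → f w ≡ false → Leaving f vs
  exit-edge f (x ∷ r) refl fa (here refl) fw = ⊥-elim (true≢false (trans (sym fa) fw))
  exit-edge f (x ∷ y ∷ r) refl fa (there p) fw with f y in fy
  ... | false = x , y , here refl , fa , fy
  ... | true  = let (x' , y' , e , h) = exit-edge f (y ∷ r) refl fy p fw in x' , y' , there e , h

  crossing-edge : (f : Fin n → Bool) → ∀ {a b} (vs : List (Fin n)) → head vs ≡ just a → last vs ≡ just b →
                  f a ≡ false → f b ≡ true → Entering f vs
  crossing-edge f (x ∷ []) refl refl fa fb = ⊥-elim (true≢false (trans (sym fb) fa))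
  crossing-edge f (x ∷ y ∷ r) refl l fa fb = step (f y) refl (crossing-edge f (y ∷ r) refl l)
    where
    step : ∀ c → f y ≡ c → (f y ≡ false → f _ ≡ true → Entering f (y ∷ r)) → Entering f (x ∷ y ∷ r)
    step true  fy _    = x , y , here refl , fa , fy
    step false fy rest = let (x' , y' , e , h) = rest fy fb in x' , y' , there e , h

  entry-edge : (f : Fin n → Bool) → ∀ {b w} (vs : List (Fin n)) → last vs ≡ just b → f b ≡ true →
               w ∈ vs → f w ≡ false → Entering f vs
  entry-edge f (x ∷ r) l fb (here refl) fw = crossing-edge f (x ∷ r) refl l fw fb
  entry-edge f (x ∷ y ∷ r) l fb (there p) fw =
    let (x' , y' , e , h) = entry-edge f (y ∷ r) l fb p fw in x' , y' , there e , h

module Immersion {n : ℕ} (A : Adj n) (A-sym : ∀ x y → A x y ≡ A y x)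
                 {k : ℕ} (K : KImmersion (suc k) A) where

  open KImmersion K

  Branch : Set
  Branch = Fin (suc k)

  record Link (p q : Branch) : Set where
    constructor link
    field
      i j  : Branch
      i<j  : i F.< j
      ends : (i ≡ p × j ≡ q) ⊎ (i ≡ q × j ≡ p)

  route : ∀ {p q} → Link p q → List (Fin n)
  route (link i j i<j _) = path i j i<j

  link-between : ∀ p q → ¬ p ≡ q → Link p q
  link-between p q p≢q with <-cmp p q
  ... | tri< p<q _ _ = link p q p<q (inj₁ (refl , refl))
  ... | tri≈ _ p≡q _ = ⊥-elim (p≢q p≡q)
  ... | tri> _ _ q<p = link q p q<p (inj₂ (refl , refl))

  Link-sym : ∀ {p q} → Link p q → Link q p
  Link-sym (link i j i<j ends) = link i j i<j (swap ends)

  at-link-ends : ∀ {p q} (P : Branch → Set) (L : Link p q) → P p → P q → P (Link.i L) × P (Link.j L)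
  at-link-ends P (link i j _ (inj₁ (refl , refl))) Pp Pq = Pp , Pq
  at-link-ends P (link i j _ (inj₂ (refl , refl))) Pp Pq = Pq , Pp

  SamePair : Branch → Branch → Branch → Branch → Set
  SamePair p q p′ q′ = (p ≡ p′ × q ≡ q′) ⊎ (p ≡ q′ × q ≡ p′)

  same-pair? : ∀ p q p′ q′ → Dec (SamePair p q p′ q′)
  same-pair? p q p′ q′ = ((p ≟ p′) ×-dec (q ≟ q′)) ⊎-dec ((p ≟ q′) ×-dec (q ≟ p′))

  links-edge-disjoint : ∀ {p q p′ q′} (L : Link p q) (L′ : Link p′ q′) → ¬ SamePair p q p′ q′ →
                        ∀ {ε ε′} → ε ∈ edgesOf (route L) → ε′ ∈ edgesOf (route L′) → ¬ SameEdge ε ε′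
  links-edge-disjoint {p} {q} {p′} {q′} (link i j i<j ends) (link i′ j′ i′<j′ ends′) distinct =
    disjoint i j i′ j′ i<j i′<j′ (different-index-pairs ends ends′) _ _
    where
    different-index-pairs : ∀ {a b a′ b′} → (a ≡ p × b ≡ q) ⊎ (a ≡ q × b ≡ p) →
                            (a′ ≡ p′ × b′ ≡ q′) ⊎ (a′ ≡ q′ × b′ ≡ p′) → ¬ (a ≡ a′ × b ≡ b′)
    different-index-pairs (inj₁ (refl , refl)) (inj₁ (refl , refl)) (refl , refl) = distinct (inj₁ (refl , refl))
    different-index-pairs (inj₁ (refl , refl)) (inj₂ (refl , refl)) (refl , refl) = distinct (inj₂ (refl , refl))
    different-index-pairs (inj₂ (refl , refl)) (inj₁ (refl , refl)) (refl , refl) = distinct (inj₂ (refl , refl))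
    different-index-pairs (inj₂ (refl , refl)) (inj₂ (refl , refl)) (refl , refl) = distinct (inj₁ (refl , refl))

  Joins : Fin n → Fin n → Fin n × Fin n → Set
  Joins x z ε = ε ≡ (x , z) ⊎ ε ≡ (z , x)

  joins-same-edge : ∀ {x z ε ε′} → Joins x z ε → Joins x z ε′ → SameEdge ε ε′
  joins-same-edge (inj₁ refl) (inj₁ refl) = inj₁ (refl , refl)
  joins-same-edge (inj₁ refl) (inj₂ refl) = inj₂ (refl , refl)
  joins-same-edge (inj₂ refl) (inj₁ refl) = inj₂ (refl , refl)
  joins-same-edge (inj₂ refl) (inj₂ refl) = inj₁ (refl , refl)

  record FirstStep {p q : Branch} (L : Link p q) : Set where
    field
      y      : Fin n
      ε      : Fin n × Fin n
      ε∈     : ε ∈ edgesOf (route L)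
      joins  : Joins (φ p) y ε
      y∈     : y ∈ route L
      y≢     : ¬ φ p ≡ y
      adj    : A (φ p) y ≡ true

  first-step : ∀ {p q} (L : Link p q) → ¬ p ≡ q → FirstStep L
  first-step (link i j i<j (inj₁ (refl , refl))) p≢q =
    let (hd , ls , linked , uniq) = path-ok i j i<j
        (y , e∈) = first-edge (path i j i<j) hd ls (λ eq → p≢q (φ-inj eq))
    in record { y = y ; ε = _ ; ε∈ = e∈ ; joins = inj₁ refl
              ; y∈ = proj₂ (edge-endpoints∈ _ e∈) ; y≢ = edge-ends-distinct _ uniq e∈
              ; adj = T⇒≡true (edge-related _ linked e∈) }
  first-step (link i j i<j (inj₂ (refl , refl))) p≢q =
    let (hd , ls , linked , uniq) = path-ok i j i<j
        (y , e∈) = last-edge (path i j i<j) hd ls (λ eq → p≢q (sym (φ-inj eq)))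
    in record { y = y ; ε = _ ; ε∈ = e∈ ; joins = inj₂ refl
              ; y∈ = proj₁ (edge-endpoints∈ _ e∈) ; y≢ = λ eq → edge-ends-distinct _ uniq e∈ (sym eq)
              ; adj = trans (A-sym (φ j) y) (T⇒≡true (edge-related _ linked e∈)) }

  other : Branch → Fin k → Branch
  other p r = punchIn p r

  other≢ : ∀ p r → ¬ p ≡ other p r
  other≢ p r eq = punchInᵢ≢i p r (sym eq)

  link-to-other : ∀ p r → Link p (other p r)
  link-to-other p r = link-between p (other p r) (other≢ p r)

  step-to-other : ∀ p r → FirstStep (link-to-other p r)
  step-to-other p r = first-step (link-to-other p r) (other≢ p r)

  -- The k links at φ p start with k distinct edges, hence reach k distinct
  -- neighbours of φ p: every branch vertex has degree at least k.
  branch-neighbour : Branch → Fin k → Fin n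
  branch-neighbour p r = FirstStep.y (step-to-other p r)

  branch-neighbour-injective : ∀ p {r r′} → branch-neighbour p r ≡ branch-neighbour p r′ → r ≡ r′
  branch-neighbour-injective p {r} {r′} same with r ≟ r′
  ... | yes r≡r′ = r≡r′
  ... | no  r≢r′ = ⊥-elim (links-edge-disjoint (link-to-other p r) (link-to-other p r′) distinct
                     (FirstStep.ε∈ s) (FirstStep.ε∈ s′)
                     (joins-same-edge (FirstStep.joins s)
                        (subst (λ y → Joins (φ p) y (FirstStep.ε s′)) (sym same) (FirstStep.joins s′))))
    where
    s  : FirstStep (link-to-other p r)
    s  = step-to-other p r
    s′ : FirstStep (link-to-other p r′)
    s′ = step-to-other p r′
    distinct : ¬ SamePair p (other p r) p (other p r′)
    distinct (inj₁ (_ , eq)) = r≢r′ (punchIn-injective p r r′ eq)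
    distinct (inj₂ (eq , _)) = other≢ p r′ eq

  branch-neighbours : Branch → List (Fin n)
  branch-neighbours p = map (branch-neighbour p) (allFin k)

  branch-neighbours-unique : ∀ p → Unique (branch-neighbours p)
  branch-neighbours-unique p = map⁺ (branch-neighbour-injective p) (allFin⁺ k)

  branch-neighbours-adjacent : ∀ p {x} → x ∈ branch-neighbours p → A (φ p) x ≡ true
  branch-neighbours-adjacent p x∈ with ∈-map⁻ (branch-neighbour p) x∈
  ... | r , _ , refl = FirstStep.adj (step-to-other p r)

  branch-neighbours-length : ∀ p → length (branch-neighbours p) ≡ k
  branch-neighbours-length p = trans (length-map (branch-neighbour p) (allFin k)) (length-tabulate {n = k} (λ z → z))

  link-ends-avoid : ∀ p {a b} (L : Link a b) → ¬ p ≡ a → ¬ p ≡ b →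
                    ¬ φ (Link.i L) ≡ φ p × ¬ φ (Link.j L) ≡ φ p
  link-ends-avoid p (link i j _ (inj₁ (refl , refl))) p≢a p≢b =
    (λ eq → p≢a (sym (φ-inj eq))) , (λ eq → p≢b (sym (φ-inj eq)))
  link-ends-avoid p (link i j _ (inj₂ (refl , refl))) p≢a p≢b =
    (λ eq → p≢b (sym (φ-inj eq))) , (λ eq → p≢a (sym (φ-inj eq)))

  -- If φ p lies inside a link not ending at p, the two edges of that link at φ p
  -- are edge-disjoint from the k links at p: φ p has k + 2 distinct neighbours.
  interior-branch-neighbours : ∀ p {a b} (L : Link a b) → ¬ p ≡ a → ¬ p ≡ b → φ p ∈ route L →
    ∃ λ xs → Unique xs × (∀ {x} → x ∈ xs → A (φ p) x ≡ true) × length xs ≡ 2 + k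
  interior-branch-neighbours p {a} {b} L@(link i j i<j _) p≢a p≢b φp∈ with path-ok i j i<j
  ... | hd , ls , linked , uniq
    with interior-edges (path i j i<j) uniq hd ls φp∈
           (proj₁ (link-ends-avoid p L p≢a p≢b)) (proj₂ (link-ends-avoid p L p≢a p≢b))
  ... | x , z , e₁ , e₂ =
    x ∷ z ∷ branch-neighbours p
    , ¬Any⇒All¬ _ (λ { (here eq) → x≢z eq ; (there w∈) → not-branch e₁ (inj₂ refl) w∈ })
      ∷ ¬Any⇒All¬ _ (not-branch e₂ (inj₁ refl)) ∷ branch-neighbours-unique p
    , (λ { (here refl)         → trans (A-sym (φ p) x) (T⇒≡true (edge-related _ linked e₁))
         ; (there (here refl)) → T⇒≡true (edge-related _ linked e₂)
         ; (there (there w∈))  → branch-neighbours-adjacent p w∈ })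
    , cong (2 +_) (branch-neighbours-length p)
    where
    distinct : ∀ r → ¬ SamePair a b p (other p r)
    distinct r (inj₁ (a≡p , _)) = p≢a (sym a≡p)
    distinct r (inj₂ (_ , b≡p)) = p≢b (sym b≡p)
    not-branch : ∀ {w ε} → ε ∈ edgesOf (path i j i<j) → Joins (φ p) w ε → ¬ w ∈ branch-neighbours p
    not-branch {w} e∈ joins w∈ with ∈-map⁻ (branch-neighbour p) w∈
    ... | r , _ , refl = links-edge-disjoint L (link-to-other p r) (distinct r) e∈
                           (FirstStep.ε∈ (step-to-other p r))
                           (joins-same-edge joins (FirstStep.joins (step-to-other p r)))
    x≢z : ¬ x ≡ z
    x≢z refl = no-edge-both-ways _ uniq e₁ e₂

  module ThreeEdgeCut (inside : Fin n → Bool) (I O : Fin 3 → Fin n)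
           (cut : ∀ x y → A x y ≡ true → inside x ≡ true → inside y ≡ false →
                  ∃ λ t → x ≡ I t × y ≡ O t) where

    cut-edge-on : ∀ {p q} (L : Link p q) → inside (φ p) ≡ true → inside (φ q) ≡ false →
                  ∃₂ λ t ε → ε ∈ edgesOf (route L) × Joins (I t) (O t) ε
    cut-edge-on (link i j i<j (inj₁ (refl , refl))) p-in q-out with path-ok i j i<j
    ... | hd , ls , linked , _ with exit-edge inside (path i j i<j) hd p-in (∈-of-last _ ls) q-out
    ... | x , y , e∈ , x-in , y-out with cut x y (T⇒≡true (edge-related _ linked e∈)) x-in y-out
    ... | t , refl , refl = t , _ , e∈ , inj₁ refl
    cut-edge-on (link i j i<j (inj₂ (refl , refl))) p-in q-out with path-ok i j i<j
    ... | hd , ls , linked , _ with entry-edge inside (path i j i<j) ls p-in (∈-of-head _ hd) q-out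
    ... | x , y , e∈ , x-out , y-in
          with cut y x (trans (A-sym y x) (T⇒≡true (edge-related _ linked e∈))) y-in x-out
    ... | t , refl , refl = t , _ , e∈ , inj₂ refl

    record Excursion {p q} (L : Link p q) : Set where
      field
        out-at in-at : Fin 3
        distinct     : ¬ out-at ≡ in-at
        leaves       : (I out-at , O out-at) ∈ edgesOf (route L)
        returns      : (O in-at , I in-at) ∈ edgesOf (route L)

    excursion : ∀ {p q} (L : Link p q) → inside (φ p) ≡ true → inside (φ q) ≡ true →
                ∀ {w} → w ∈ route L → inside w ≡ false → Excursion L
    excursion L@(link i j i<j _) p-in q-in w∈ w-out with path-ok i j i<j
    ... | hd , ls , linked , uniq
      with at-link-ends (λ b → inside (φ b) ≡ true) L p-in q-in
    ... | i-in , j-in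
      with exit-edge inside (path i j i<j) hd i-in w∈ w-out | entry-edge inside (path i j i<j) ls j-in w∈ w-out
    ... | x , y , e∈ , x-in , y-out | x′ , y′ , e′∈ , x′-out , y′-in
      with cut x y (T⇒≡true (edge-related _ linked e∈)) x-in y-out
         | cut y′ x′ (trans (A-sym y′ x′) (T⇒≡true (edge-related _ linked e′∈))) y′-in x′-out
    ... | t , refl , refl | t′ , refl , refl = record
      { out-at = t ; in-at = t′ ; distinct = λ { refl → no-edge-both-ways _ uniq e∈ e′∈ }
      ; leaves = e∈ ; returns = e′∈ }

    -- Two excursions use four cut edges out of three, so they cannot belong to
    -- links of distinct pairs.
    no-two-excursions : ∀ {p q p′ q′} (L : Link p q) (L′ : Link p′ q′) → ¬ SamePair p q p′ q′ →
                        Excursion L → Excursion L′ → ⊥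
    no-two-excursions L L′ distinct X X′
      with two-pairs-in-Fin3-meet (Excursion.out-at X) (Excursion.in-at X)
                                   (Excursion.out-at X′) (Excursion.in-at X′)
                                   (Excursion.distinct X) (Excursion.distinct X′)
    ... | inj₁ (inj₁ refl) = links-edge-disjoint L L′ distinct (Excursion.leaves X)  (Excursion.leaves X′)  (inj₁ (refl , refl))
    ... | inj₁ (inj₂ refl) = links-edge-disjoint L L′ distinct (Excursion.leaves X)  (Excursion.returns X′) (inj₂ (refl , refl))
    ... | inj₂ (inj₁ refl) = links-edge-disjoint L L′ distinct (Excursion.returns X) (Excursion.leaves X′)  (inj₂ (refl , refl))
    ... | inj₂ (inj₂ refl) = links-edge-disjoint L L′ distinct (Excursion.returns X) (Excursion.returns X′) (inj₁ (refl , refl))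

    -- If p₀ is inside and v outside, every other branch vertex w ≠ v is joined
    -- across the cut, to v (if w is inside) or to p₀ (if w is outside).
    record Crossing (p₀ v : Branch) (r : Fin k) : Set where
      field
        c     : Branch
        c∈    : c ≡ v ⊎ c ≡ p₀
        L     : Link c (other v r)
        t     : Fin 3
        ε     : Fin n × Fin n
        ε∈    : ε ∈ edgesOf (route L)
        joins : Joins (I t) (O t) ε

    crossing : ∀ {p₀ v} → inside (φ p₀) ≡ true → inside (φ v) ≡ false → ∀ r → Crossing p₀ v r
    crossing {p₀} {v} p₀-in v-out r with inside (φ (other v r)) in w-in
    ... | true =
      let (t , ε , ε∈ , joins) = cut-edge-on (Link-sym (link-to-other v r)) w-in v-out
      in record { c = v ; c∈ = inj₁ refl ; L = link-to-other v r ; t = t ; ε = ε ; ε∈ = ε∈ ; joins = joins }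
    ... | false =
      let L = link-between p₀ (other v r) (λ { refl → true≢false (trans (sym p₀-in) w-in) })
          (t , ε , ε∈ , joins) = cut-edge-on L p₀-in w-in
      in record { c = p₀ ; c∈ = inj₂ refl ; L = L ; t = t ; ε = ε ; ε∈ = ε∈ ; joins = joins }

    crossings-distinct : ∀ {p₀ v r r′} → ¬ p₀ ≡ v → ¬ r ≡ r′ → (X : Crossing p₀ v r) (X′ : Crossing p₀ v r′) →
                         ¬ SamePair (Crossing.c X) (other v r) (Crossing.c X′) (other v r′)
    crossings-distinct {p₀} {v} {r} {r′} p₀≢v r≢r′ X X′ same = r≢r′ (punchIn-injective v r r′ (others-equal same))
      where
      is-p₀ : ∀ {c} s → c ≡ v ⊎ c ≡ p₀ → other v s ≡ c → other v s ≡ p₀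
      is-p₀ s (inj₁ refl) eq = ⊥-elim (other≢ v s (sym eq))
      is-p₀ s (inj₂ refl) eq = eq
      others-equal : SamePair (Crossing.c X) (other v r) (Crossing.c X′) (other v r′) → other v r ≡ other v r′
      others-equal (inj₁ (_ , eq))      = eq
      others-equal (inj₂ (eq′ , eq))    =
        trans (is-p₀ r (Crossing.c∈ X′) eq) (sym (is-p₀ r′ (Crossing.c∈ X) (sym eq′)))

    -- With more than three other branch vertices, these k crossings cannot all
    -- use different cut edges: the branch vertices are all inside or all outside.
    all-inside : 3 < k → ∀ {p₀} → inside (φ p₀) ≡ true → ∀ v → inside (φ v) ≡ true
    all-inside 3<k {p₀} p₀-in v with inside (φ v) in v-in
    ... | true  = refl
    ... | false with pigeonhole 3<k (λ r → Crossing.t (crossing p₀-in v-in r))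
    ... | r , r′ , r<r′ , same-t = ⊥-elim
          (links-edge-disjoint (Crossing.L X) (Crossing.L X′)
             (crossings-distinct p₀≢v (<⇒≢ r<r′) X X′) (Crossing.ε∈ X) (Crossing.ε∈ X′)
             (joins-same-edge (Crossing.joins X)
                (subst (λ t → Joins (I t) (O t) (Crossing.ε X′)) (sym same-t) (Crossing.joins X′))))
      where
      X  : Crossing p₀ v r
      X  = crossing p₀-in v-in r
      X′ : Crossing p₀ v r′
      X′ = crossing p₀-in v-in r′
      p₀≢v : ¬ p₀ ≡ v
      p₀≢v refl = true≢false (trans (sym p₀-in) v-in)

-- In P_d every vertex a is non-adjacent to at most two other vertices, its
-- partners: along the deleted 2-paths 0-1-2, 3-4-5, 6-7-8, or in the deleted
-- matching {9,10}, {11,12}, ….  The two partners differ only at the middle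
-- vertices 1, 4, 7.
partner₁ partner₂ : ℕ → ℕ
partner₁ 0 = 1
partner₁ 1 = 0
partner₁ 2 = 1
partner₁ 3 = 4
partner₁ 4 = 3
partner₁ 5 = 4
partner₁ 6 = 7
partner₁ 7 = 6
partner₁ 8 = 7
partner₁ (suc (suc (suc (suc (suc (suc (suc (suc (suc r))))))))) = if r % 2 ≡ᵇ 0 then 10 + r else 8 + r
partner₂ 1 = 2
partner₂ 4 = 5
partner₂ 7 = 8
partner₂ a = partner₁ a

IsPartner : ℕ → ℕ → Set
IsPartner a b = b ≡ partner₁ a ⊎ b ≡ partner₂ a

partners-agree : ∀ a → ¬ a ≡ 1 → ¬ a ≡ 4 → ¬ a ≡ 7 → partner₁ a ≡ partner₂ a
partners-agree 1 a≢1 _   _   = ⊥-elim (a≢1 refl)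
partners-agree 4 _   a≢4 _   = ⊥-elim (a≢4 refl)
partners-agree 7 _   _   a≢7 = ⊥-elim (a≢7 refl)
partners-agree 0 _ _ _ = refl
partners-agree 2 _ _ _ = refl
partners-agree 3 _ _ _ = refl
partners-agree 5 _ _ _ = refl
partners-agree 6 _ _ _ = refl
partners-agree 8 _ _ _ = refl
partners-agree (suc (suc (suc (suc (suc (suc (suc (suc (suc r))))))))) _ _ _ = refl

path-partners : ∀ a b → T (pathEdge a b) → IsPartner a b × IsPartner b a
path-partners a b t with T-∨⁻ ((a ≡ᵇ 0) ∧ (b ≡ᵇ 1)) t
... | inj₁ t₀₁ with T-≡ᵇ-pair {a} {b} 0 1 t₀₁
...   | refl , refl = inj₁ refl , inj₁ refl
path-partners a b t | inj₂ t₁ with T-∨⁻ ((a ≡ᵇ 1) ∧ (b ≡ᵇ 2)) t₁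
... | inj₁ t₁₂ with T-≡ᵇ-pair {a} {b} 1 2 t₁₂
...   | refl , refl = inj₂ refl , inj₁ refl
path-partners a b t | inj₂ _ | inj₂ t₂ with T-∨⁻ ((a ≡ᵇ 3) ∧ (b ≡ᵇ 4)) t₂
... | inj₁ t₃₄ with T-≡ᵇ-pair {a} {b} 3 4 t₃₄
...   | refl , refl = inj₁ refl , inj₁ refl
path-partners a b t | inj₂ _ | inj₂ _ | inj₂ t₃ with T-∨⁻ ((a ≡ᵇ 4) ∧ (b ≡ᵇ 5)) t₃
... | inj₁ t₄₅ with T-≡ᵇ-pair {a} {b} 4 5 t₄₅
...   | refl , refl = inj₂ refl , inj₁ refl
path-partners a b t | inj₂ _ | inj₂ _ | inj₂ _ | inj₂ t₄ with T-∨⁻ ((a ≡ᵇ 6) ∧ (b ≡ᵇ 7)) t₄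
... | inj₁ t₆₇ with T-≡ᵇ-pair {a} {b} 6 7 t₆₇
...   | refl , refl = inj₁ refl , inj₁ refl
path-partners a b t | inj₂ _ | inj₂ _ | inj₂ _ | inj₂ _ | inj₂ t₇₈ with T-≡ᵇ-pair {a} {b} 7 8 t₇₈
...   | refl , refl = inj₂ refl , inj₁ refl

even⇒suc-odd : ∀ r → r % 2 ≡ 0 → suc r % 2 ≡ 1
even⇒suc-odd r r-even = begin
  suc r % 2                  ≡⟨ cong (_% 2) (+-comm 1 r) ⟩
  (r + 1) % 2                ≡⟨ %-distribˡ-+ r 1 2 ⟩
  ((r % 2) + (1 % 2)) % 2    ≡⟨ cong (λ z → (z + 1) % 2) r-even ⟩
  1                          ∎
  where open ≡-Reasoning

match-partners : ∀ a b → T (matchEdge a b) → IsPartner a b × IsPartner b a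
match-partners a b t with T-∧⁻ (9 ≤ᵇ a) t
... | a≥9 , t′ with T-∧⁻ (((a ∸ 9) % 2) ≡ᵇ 0) t′
... | even , b≡1+a = matched a b a≥9 (≡ᵇ⇒≡ _ 0 even) (≡ᵇ⇒≡ b (suc a) b≡1+a)
  where
  matched : ∀ a b → T (9 ≤ᵇ a) → (a ∸ 9) % 2 ≡ 0 → b ≡ suc a → IsPartner a b × IsPartner b a
  matched (suc (suc (suc (suc (suc (suc (suc (suc (suc r))))))))) _ _ r-even refl
    rewrite r-even | even⇒suc-odd r r-even = inj₁ refl , inj₁ refl

deleted⇒partner : ∀ a b → T (deletedP a b) → IsPartner a b
deleted⇒partner a b t with T-∨⁻ (pathEdge a b) t
... | inj₁ p = proj₁ (path-partners a b p)
... | inj₂ t₁ with T-∨⁻ (pathEdge b a) t₁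
... | inj₁ p = proj₂ (path-partners b a p)
... | inj₂ t₂ with T-∨⁻ (matchEdge a b) t₂
... | inj₁ p = proj₁ (match-partners a b p)
... | inj₂ p = proj₂ (match-partners b a p)

deletedP-sym : ∀ a b → deletedP a b ≡ deletedP b a
deletedP-sym a b = rearrange (pathEdge a b) (pathEdge b a) (matchEdge a b) (matchEdge b a)
  where
  rearrange : ∀ p q r s → (p ∨ (q ∨ (r ∨ s))) ≡ (q ∨ (p ∨ (s ∨ r)))
  rearrange true  true  _     _     = refl
  rearrange true  false _     _     = refl
  rearrange false true  _     _     = refl
  rearrange false false true  true  = refl
  rearrange false false true  false = refl
  rearrange false false false true  = refl
  rearrange false false false false = refl

adjP-sym : ∀ {d} (x y : Fin (suc d)) → adjP x y ≡ adjP y x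
adjP-sym x y rewrite ≡ᵇ-sym (toℕ x) (toℕ y) | deletedP-sym (toℕ x) (toℕ y) = refl

non-adjacent⇒partner : ∀ {d} (x y : Fin (suc d)) → adjP x y ≡ false →
                       toℕ y ≡ toℕ x ⊎ IsPartner (toℕ x) (toℕ y)
non-adjacent⇒partner x y _ with toℕ x ≡ᵇ toℕ y in same
... | true = inj₁ (sym (≡ᵇ⇒≡ (toℕ x) (toℕ y) (subst T (sym same) _)))
... | false with deletedP (toℕ x) (toℕ y) in del
...   | true = inj₂ (deleted⇒partner (toℕ x) (toℕ y) (subst T (sym del) _))

adjP-irreflexive : ∀ {d} (l : Fin (suc d)) → adjP l l ≡ false
adjP-irreflexive l rewrite ≡ᵇ-refl (toℕ l) = refl

module _ {d : ℕ} where

  P-neighbours P-non-neighbours : Fin (suc d) → List (Fin (suc d))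
  P-neighbours     l = filter (λ l′ → T? (adjP l l′)) (allFin (suc d))
  P-non-neighbours l = filter (λ l′ → T? (not (adjP l l′))) (allFin (suc d))

  P-split : ∀ l → length (P-non-neighbours l) + length (P-neighbours l) ≡ suc d
  P-split l = trans (filter-complement (adjP l) (allFin (suc d))) (length-tabulate {n = suc d} (λ z → z))

  P-non-neighbours-⊆ : ∀ l {x} → x ∈ map toℕ (P-non-neighbours l) →
                       x ∈ toℕ l ∷ partner₁ (toℕ l) ∷ partner₂ (toℕ l) ∷ []
  P-non-neighbours-⊆ l x∈ with ∈-map⁻ toℕ x∈
  ... | l′ , l′∈ , refl
    with non-adjacent⇒partner l l′ (T-not⇒≡false (proj₂ (∈-filter⁻ (λ l′ → T? (not (adjP l l′))) {xs = allFin (suc d)} l′∈)))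
  ... | inj₁ same         = here same
  ... | inj₂ (inj₁ p₁)    = there (here p₁)
  ... | inj₂ (inj₂ p₂)    = there (there (here p₂))

  P-non-neighbours-unique : ∀ l → Unique (map toℕ (P-non-neighbours l))
  P-non-neighbours-unique l = map⁺ toℕ-injective (filter⁺ (λ l′ → T? (not (adjP l l′))) (allFin⁺ (suc d)))

  P-non-neighbours-≤3 : ∀ l → length (P-non-neighbours l) ≤ 3
  P-non-neighbours-≤3 l = subst (_≤ 3) (length-map toℕ (P-non-neighbours l))
    (unique⊆⇒length≤ _ _ (P-non-neighbours-unique l) (P-non-neighbours-⊆ l))

  P-non-neighbours-≤2 : ∀ l → partner₁ (toℕ l) ≡ partner₂ (toℕ l) → length (P-non-neighbours l) ≤ 2
  P-non-neighbours-≤2 l agree = subst (_≤ 2) (length-map toℕ (P-non-neighbours l))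
    (unique⊆⇒length≤ _ (toℕ l ∷ partner₁ (toℕ l) ∷ []) (P-non-neighbours-unique l) drop-partner₂)
    where
    drop-partner₂ : ∀ {x} → x ∈ map toℕ (P-non-neighbours l) → x ∈ toℕ l ∷ partner₁ (toℕ l) ∷ []
    drop-partner₂ x∈ with P-non-neighbours-⊆ l x∈
    ... | here eq                 = here eq
    ... | there (here eq)         = there (here eq)
    ... | there (there (here eq)) = there (here (trans eq (sym agree)))

pattern path₀ = F.zero
pattern path₁ = F.suc F.zero
pattern path₂ = F.suc (F.suc F.zero)

module GdFacts (e m : ℕ) (att : Fin m → Fin 3 → Fin (5 + e)) where

  D : ℕ
  D = 8 + e

  N : ℕ
  N = Gsize D m

  G : Adj N
  G = Gd D m att

  Label : Set
  Label = Fin (suc D)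

  vertex : VKind D m → Fin N
  vertex (kv k)   = k ↑ˡ (m * suc D)
  vertex (cv j l) = (5 + e) ↑ʳ combine j l

  clique : Fin (5 + e) → Fin N
  clique k = vertex (kv k)

  copy : Fin m → Label → Fin N
  copy j l = vertex (cv j l)

  kind-vertex : ∀ v → kind D m (vertex v) ≡ v
  kind-vertex (kv k)   rewrite splitAt-↑ˡ (5 + e) k (m * suc D) = refl
  kind-vertex (cv j l) rewrite splitAt-↑ʳ (5 + e) (m * suc D) (combine j l) =
    cong (λ (j , l) → cv j l) (remQuot-combine {m} {suc D} j l)

  vertex-kind : ∀ x → vertex (kind D m x) ≡ x
  vertex-kind x with splitAt (5 + e) x in split
  ... | inj₁ k = trans (cong (join (5 + e) (m * suc D)) (sym split)) (join-splitAt (5 + e) (m * suc D) x)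
  ... | inj₂ r = trans (cong ((5 + e) ↑ʳ_) (combine-remQuot {m} (suc D) r))
                       (trans (cong (join (5 + e) (m * suc D)) (sym split)) (join-splitAt (5 + e) (m * suc D) x))

  vertex-injective : ∀ {u v} → vertex u ≡ vertex v → u ≡ v
  vertex-injective {u} {v} eq = trans (sym (kind-vertex u)) (trans (cong (kind D m) eq) (kind-vertex v))

  mid prev next : Fin 3 → Label
  mid  path₀                 = # 1
  mid  path₁         = # 4
  mid  path₂ = # 7
  prev path₀                 = # 0
  prev path₁         = # 3
  prev path₂ = # 6
  next path₀                 = # 2
  next path₁         = # 5
  next path₂ = # 8

  mid-injective : ∀ {t s} → mid t ≡ mid s → t ≡ s
  mid-injective {path₀}                 {path₀}                 _ = refl
  mid-injective {path₁}           {path₁}           _ = refl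
  mid-injective {path₂}   {path₂}   _ = refl
  mid-injective {path₀}                 {path₁}           ()
  mid-injective {path₀}                 {path₂}   ()
  mid-injective {path₁}           {path₀}                 ()
  mid-injective {path₁}           {path₂}   ()
  mid-injective {path₂}   {path₀}                 ()
  mid-injective {path₂}   {path₁}           ()

  mid≁prev : ∀ t → adjP (mid t) (prev t) ≡ false
  mid≁prev path₀                 = refl
  mid≁prev path₁         = refl
  mid≁prev path₂ = refl

  mid≁next : ∀ t → adjP (mid t) (next t) ≡ false
  mid≁next path₀                 = refl
  mid≁next path₁         = refl
  mid≁next path₂ = refl

  middle? : ∀ l → Dec (∃ λ t → l ≡ mid t)
  middle? l = any? (λ t → l ≟ mid t)

  not-middle⇒partners-agree : ∀ {l} → ¬ (∃ λ t → l ≡ mid t) → partner₁ (toℕ l) ≡ partner₂ (toℕ l)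
  not-middle⇒partners-agree {l} ¬mid = partners-agree (toℕ l)
    (λ eq → ¬mid (path₀ , toℕ-injective eq))
    (λ eq → ¬mid (path₁ , toℕ-injective eq))
    (λ eq → ¬mid (path₂ , toℕ-injective eq))

  attachment-view : ∀ k j l → attached att k j l ≡ true → ∃ λ t → l ≡ mid t × att j t ≡ k
  attachment-view k j l a with T-∨⁻ _ (subst T (sym a) _)
  ... | inj₁ a₀ = let (l≡ , k≡) = T-∧⁻ _ a₀ in
    path₀ , toℕ-injective (≡ᵇ⇒≡ (toℕ l) 1 l≡) , toℕ-injective (≡ᵇ⇒≡ _ _ k≡)
  ... | inj₂ a′ with T-∨⁻ _ a′
  ...   | inj₁ a₁ = let (l≡ , k≡) = T-∧⁻ _ a₁ in
    path₁ , toℕ-injective (≡ᵇ⇒≡ (toℕ l) 4 l≡) , toℕ-injective (≡ᵇ⇒≡ _ _ k≡)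
  ...   | inj₂ a₂ = let (l≡ , k≡) = T-∧⁻ _ a₂ in
    path₂ , toℕ-injective (≡ᵇ⇒≡ (toℕ l) 7 l≡) , toℕ-injective (≡ᵇ⇒≡ _ _ k≡)

  attachment-edge : ∀ j t → G (copy j (mid t)) (clique (att j t)) ≡ true
  attachment-edge j t rewrite kind-vertex (cv j (mid t)) | kind-vertex (kv {D} {m} (att j t)) = edge t
    where
    edge : ∀ t → attached att (att j t) j (mid t) ≡ true
    edge path₀                 rewrite ≡ᵇ-refl (toℕ (att j path₀)) = refl
    edge path₁         rewrite ≡ᵇ-refl (toℕ (att j path₁)) = refl
    edge path₂ rewrite ≡ᵇ-refl (toℕ (att j path₂)) = refl

  copy-edge : ∀ j {l l′} → adjP l l′ ≡ true → G (copy j l) (copy j l′) ≡ true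
  copy-edge j {l} {l′} a rewrite kind-vertex (cv j l) | kind-vertex (cv j l′) | ≡ᵇ-refl (toℕ j) = a

  G-sym : ∀ x y → G x y ≡ G y x
  G-sym x y = symmetric (kind D m x) (kind D m y)
    where
    symmetric : ∀ u v → adjKind att u v ≡ adjKind att v u
    symmetric (kv k)   (kv k′)   = cong not (≡ᵇ-sym (toℕ k) (toℕ k′))
    symmetric (kv k)   (cv j l)  = refl
    symmetric (cv j l) (kv k)    = refl
    symmetric (cv j l) (cv j′ l′) = cong₂ _∧_ (≡ᵇ-sym (toℕ j) (toℕ j′)) (adjP-sym l l′)

  data CopyNeighbour (j : Fin m) (l : Label) : Fin N → Set where
    within     : ∀ {l′} → adjP l l′ ≡ true → CopyNeighbour j l (copy j l′)
    attachment : ∀ t → l ≡ mid t → CopyNeighbour j l (clique (att j t))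

  copy-neighbour : ∀ j l {x} → G (copy j l) x ≡ true → CopyNeighbour j l x
  copy-neighbour j l {x} adj =
    subst (CopyNeighbour j l) (vertex-kind x)
          (classify (kind D m x) (subst (λ u → adjKind att u (kind D m x) ≡ true) (kind-vertex (cv j l)) adj))
    where
    classify : ∀ u → adjKind att (cv j l) u ≡ true → CopyNeighbour j l (vertex u)
    classify (kv k) a with attachment-view k j l a
    ... | t , l≡ , refl = attachment t l≡
    classify (cv j′ l′) a with toℕ j ≡ᵇ toℕ j′ in same
    ... | true rewrite toℕ-injective {i = j} {j = j′} (≡ᵇ⇒≡ (toℕ j) (toℕ j′) (subst T (sym same) _)) = within a

  -- The label a neighbour carries: its own label within the copy, or the label
  -- l itself for the attachment vertex.  Distinct neighbours carry distinct labels.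
  label : ∀ {j l x} → CopyNeighbour j l x → Label
  label (within {l′} _) = l′
  label {l = l} (attachment _ _) = l

  label-injective : ∀ {j l x y} (v : CopyNeighbour j l x) (w : CopyNeighbour j l y) → label v ≡ label w → x ≡ y
  label-injective (within _) (within _) refl = refl
  label-injective (attachment t l≡) (attachment s l≡′) _
    rewrite mid-injective {t} {s} (trans (sym l≡) l≡′) = refl
  label-injective {l = l} (within a) (attachment _ _) refl rewrite adjP-irreflexive l with a
  ... | ()
  label-injective {l = l} (attachment _ _) (within a) refl rewrite adjP-irreflexive l with a
  ... | ()

  local-label : Label → Fin N → Label
  local-label l x with kind D m x
  ... | kv _    = l
  ... | cv _ l′ = l′

  label≡local-label : ∀ {j l x} (v : CopyNeighbour j l x) → label v ≡ local-label l x
  label≡local-label {j} {l} (within {l′} _) rewrite kind-vertex (cv j l′) = refl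
  label≡local-label {j} {l} (attachment t _) rewrite kind-vertex (kv {D} {m} (att j t)) = refl

  non-adjacent-label : ∀ {j l x} (v : CopyNeighbour j l x) → adjP l (label v) ≡ false →
                       ∃ λ t → l ≡ mid t × x ≡ clique (att j t) × label v ≡ l
  non-adjacent-label (within a) na = ⊥-elim (true≢false (trans (sym a) na))
  non-adjacent-label (attachment t l≡) _ = t , l≡ , refl , refl

  copy-neighbours-bound : ∀ j l (Fs : List Label) (xs : List (Fin N)) → Unique Fs → Unique xs →
    (∀ {x} → x ∈ xs → G (copy j l) x ≡ true) →
    (∀ {l′} → l′ ∈ Fs → adjP l l′ ≡ false) →
    (∀ t → l ≡ mid t → clique (att j t) ∈ xs → l ∈ Fs → ⊥) →
    length Fs + length xs ≤ suc D
  copy-neighbours-bound j l Fs xs uFs uxs adj Fs≁l attachment-avoided =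
    subst (λ n → length Fs + n ≤ suc D) (length-map (local-label l) xs)
      (avoiding⇒length≤ Fs (map (local-label l) xs) uFs
        (map-unique (local-label l) xs uxs labels-differ) label-avoids)
    where
    view : ∀ {x} → x ∈ xs → CopyNeighbour j l x
    view {x} x∈ = copy-neighbour j l {x} (adj x∈)
    labels-differ : ∀ {x y} → x ∈ xs → y ∈ xs → local-label l x ≡ local-label l y → x ≡ y
    labels-differ x∈ y∈ eq = label-injective (view x∈) (view y∈)
      (trans (label≡local-label (view x∈)) (trans eq (sym (label≡local-label (view y∈)))))
    label-avoids : ∀ {c} → c ∈ Fs → c ∈ map (local-label l) xs → ⊥
    label-avoids c∈Fs c∈ with ∈-map⁻ (local-label l) c∈
    ... | x , x∈ , refl
      with non-adjacent-label (view x∈) (subst (λ c → adjP l c ≡ false) (sym (label≡local-label (view x∈))) (Fs≁l c∈Fs))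
    ... | t , l≡ , refl , label≡l = attachment-avoided t l≡ x∈
            (subst (_∈ Fs) (trans (sym (label≡local-label (view x∈))) label≡l) c∈Fs)

  -- Previous, middle and next vertices are told apart by their labels mod 3.
  position : Label → ℕ
  position l = toℕ l % 3

  position-prev : ∀ t → position (prev t) ≡ 0
  position-prev path₀                 = refl
  position-prev path₁         = refl
  position-prev path₂ = refl

  position-mid : ∀ t → position (mid t) ≡ 1
  position-mid path₀                 = refl
  position-mid path₁         = refl
  position-mid path₂ = refl

  position-next : ∀ t → position (next t) ≡ 2
  position-next path₀                 = refl
  position-next path₁         = refl
  position-next path₂ = refl

  prev≢mid : ∀ t s → ¬ prev t ≡ mid s
  prev≢mid t s eq with trans (sym (position-prev t)) (trans (cong position eq) (position-mid s))
  ... | ()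

  next≢mid : ∀ t s → ¬ next t ≡ mid s
  next≢mid t s eq with trans (sym (position-next t)) (trans (cong position eq) (position-mid s))
  ... | ()

  prev≢next : ∀ t s → ¬ prev t ≡ next s
  prev≢next t s eq with trans (sym (position-prev t)) (trans (cong position eq) (position-next s))
  ... | ()

  mid-prev-next-distinct : ∀ t → Unique (mid t ∷ prev t ∷ next t ∷ [])
  mid-prev-next-distinct t =
    ((λ eq → prev≢mid t t (sym eq)) ∷ (λ eq → next≢mid t t (sym eq)) ∷ []) ∷ (prev≢next t t ∷ []) ∷ [] ∷ []

  copy-neighbours-≤ : ∀ j l (xs : List (Fin N)) → Unique xs → (∀ {x} → x ∈ xs → G (copy j l) x ≡ true) →
                      length xs ≤ D
  copy-neighbours-≤ j l xs uxs adj with middle? l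
  ... | yes (t , refl) = s≤s⁻¹ (copy-neighbours-bound j (mid t) (next t ∷ []) xs ([] ∷ []) uxs adj
                           (λ { (here refl) → mid≁next t }) (λ { _ _ _ (here eq) → next≢mid t t (sym eq) }))
  ... | no ¬mid        = s≤s⁻¹ (copy-neighbours-bound j l (l ∷ []) xs ([] ∷ []) uxs adj
                           (λ { (here refl) → adjP-irreflexive l }) (λ t l≡ _ _ → ¬mid (t , l≡)))

  middle-inner-neighbours-≤ : ∀ j t (xs : List (Fin N)) → Unique xs →
                              (∀ {x} → x ∈ xs → G (copy j (mid t)) x ≡ true) →
                              ¬ clique (att j t) ∈ xs → length xs ≤ 6 + e
  middle-inner-neighbours-≤ j t xs uxs adj no-attachment =
    +-cancelˡ-≤ 3 _ _ (copy-neighbours-bound j (mid t) (mid t ∷ prev t ∷ next t ∷ []) xs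
                         (mid-prev-next-distinct t) uxs adj non-adjacent attachment-excluded)
    where
    non-adjacent : ∀ {l′} → l′ ∈ mid t ∷ prev t ∷ next t ∷ [] → adjP (mid t) l′ ≡ false
    non-adjacent (here refl)                 = adjP-irreflexive (mid t)
    non-adjacent (there (here refl))         = mid≁prev t
    non-adjacent (there (there (here refl))) = mid≁next t
    attachment-excluded : ∀ s → mid t ≡ mid s → clique (att j s) ∈ xs → mid t ∈ mid t ∷ prev t ∷ next t ∷ [] → ⊥
    attachment-excluded s eq s∈ _ rewrite mid-injective {t} {s} eq = no-attachment s∈

  corner-degree : ∀ j → degree G (copy j (# 0)) ≤ 7 + e
  corner-degree j =
    +-cancelˡ-≤ 2 _ _ (subst (λ n → 2 + n ≤ suc D) (sym (degree≡length-neighbours G w))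
      (copy-neighbours-bound j (# 0) (# 0 ∷ # 1 ∷ []) (neighbours G w) (((λ ()) ∷ []) ∷ [] ∷ [])
        (neighbours-unique G w) (neighbours-adjacent G w)
        (λ { (here refl) → refl ; (there (here refl)) → refl }) corner-not-middle))
    where
    w : Fin N
    w = copy j (# 0)
    corner-not-middle : ∀ t → # 0 ≡ mid t → clique (att j t) ∈ neighbours G w → # 0 ∈ # 0 ∷ # 1 ∷ [] → ⊥
    corner-not-middle path₀                 ()
    corner-not-middle path₁         ()
    corner-not-middle path₂ ()

  inner : Fin m → Label → List (Fin N)
  inner j l = map (copy j) (P-neighbours l)

  inner-unique : ∀ j l → Unique (inner j l)
  inner-unique j l = map⁺ (λ eq → cv-injective (vertex-injective eq)) (filter⁺ (λ l′ → T? (adjP l l′)) (allFin⁺ (suc D)))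
    where
    cv-injective : ∀ {a b} → cv {D} {m} j a ≡ cv j b → a ≡ b
    cv-injective refl = refl

  inner-adjacent : ∀ j l {x} → x ∈ inner j l → G (copy j l) x ≡ true
  inner-adjacent j l x∈ with ∈-map⁻ (copy j) x∈
  ... | l′ , l′∈ , refl = copy-edge j (T⇒≡true (proj₂ (∈-filter⁻ (λ l′ → T? (adjP l l′)) {xs = allFin (suc D)} l′∈)))

  -- Every copy vertex has degree at least d - 1: it misses at most two vertices
  -- of its copy, or three for a middle vertex, which has its attachment instead.
  copy-degree-≥ : ∀ j l → 7 + e ≤ degree G (copy j l)
  copy-degree-≥ j l with middle? l
  ... | no ¬mid =
    ≤-trans (complement-bound (P-split l) (P-non-neighbours-≤2 l (not-middle⇒partners-agree ¬mid)))
            (subst (_≤ degree G (copy j l)) (length-map (copy j) (P-neighbours l))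
                   (neighbour-list≤degree G (copy j l) (inner j l) (inner-unique j l) (inner-adjacent j l)))
  ... | yes (t , refl) =
    ≤-trans (s≤s (complement-bound (P-split (mid t)) (P-non-neighbours-≤3 (mid t))))
            (subst (λ n → suc n ≤ degree G (copy j (mid t))) (length-map (copy j) (P-neighbours (mid t)))
                   (neighbour-list≤degree G (copy j (mid t)) (clique (att j t) ∷ inner j (mid t))
                     (¬Any⇒All¬ _ not-inner ∷ inner-unique j (mid t)) with-attachment))
    where
    not-inner : ¬ clique (att j t) ∈ inner j (mid t)
    not-inner x∈ with ∈-map⁻ (copy j) x∈
    ... | l′ , _ , eq with vertex-injective {kv (att j t)} {cv j l′} eq
    ... | ()
    with-attachment : ∀ {x} → x ∈ clique (att j t) ∷ inner j (mid t) → G (copy j (mid t)) x ≡ true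
    with-attachment (here refl) = attachment-edge j t
    with-attachment (there x∈)  = inner-adjacent j (mid t) x∈

  in-copy : Fin m → Fin N → Bool
  in-copy j x with kind D m x
  ... | kv _    = false
  ... | cv j′ _ = toℕ j ≡ᵇ toℕ j′

  in-copy-copy : ∀ j l → in-copy j (copy j l) ≡ true
  in-copy-copy j l rewrite kind-vertex (cv j l) = ≡ᵇ-refl (toℕ j)

  in-copy-clique : ∀ j k → in-copy j (clique k) ≡ false
  in-copy-clique j k rewrite kind-vertex (kv {D} {m} k) = refl

  in-copy⇒copy : ∀ j x → in-copy j x ≡ true → ∃ λ l → x ≡ copy j l
  in-copy⇒copy j x inside with kind D m x in kx
  ... | cv j′ l rewrite toℕ-injective {i = j} {j = j′} (≡ᵇ⇒≡ (toℕ j) (toℕ j′) (subst T (sym inside) _)) =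
    l , trans (sym (vertex-kind x)) (cong vertex kx)

  clique-vertex : ∀ x → (∀ j → ¬ in-copy j x ≡ true) → ∃ λ k → x ≡ clique k
  clique-vertex x not-in = classify (kind D m x) refl
    where
    classify : ∀ u → kind D m x ≡ u → ∃ λ k → x ≡ clique k
    classify (kv k)   kx = k , trans (sym (vertex-kind x)) (cong vertex kx)
    classify (cv j l) kx = ⊥-elim (not-in j (subst (λ y → in-copy j y ≡ true)
                             (trans (cong vertex (sym kx)) (vertex-kind x)) (in-copy-copy j l)))

  clique-no-loop : ∀ k → G (clique k) (clique k) ≡ false
  clique-no-loop k rewrite kind-vertex (kv {D} {m} k) | ≡ᵇ-refl (toℕ k) = refl

  clique-degree-without-copies : ¬ Fin m → ∀ k → degree G (clique k) ≤ 4 + e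
  clique-degree-without-copies no-copy k =
    s≤s⁻¹ (subst (λ n → 1 + n ≤ 5 + e) (trans (length-map index nbrs) (sym (degree≡length-neighbours G (clique k))))
      (avoiding⇒length≤ (k ∷ []) (map index nbrs) ([] ∷ [])
        (map⁺ index-injective (neighbours-unique G (clique k))) not-self))
    where
    nbrs : List (Fin N)
    nbrs = neighbours G (clique k)
    as-clique : ∀ x → ∃ λ k′ → x ≡ clique k′
    as-clique x = clique-vertex x (λ j → ⊥-elim (no-copy j))
    index : Fin N → Fin (5 + e)
    index x = proj₁ (as-clique x)
    index-injective : ∀ {x y} → index x ≡ index y → x ≡ y
    index-injective {x} {y} eq = trans (proj₂ (as-clique x)) (trans (cong clique eq) (sym (proj₂ (as-clique y))))
    not-self : ∀ {c} → c ∈ k ∷ [] → c ∈ map index nbrs → ⊥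
    not-self (here refl) c∈ with ∈-map⁻ index c∈
    ... | x , x∈ , eq = true≢false (trans (sym (neighbours-adjacent G (clique k) x∈))
                          (subst (λ y → G (clique k) y ≡ false) x≡clique-k (clique-no-loop k)))
      where
      x≡clique-k : clique k ≡ x
      x≡clique-k = trans (cong clique eq) (sym (proj₂ (as-clique x)))

  -- If every clique vertex has degree at least d - 1, the minimum degree is d - 1,
  -- attained at the corner vertex of a copy (and copies must exist).
  minimum-degree : (∀ k → 7 + e ≤ degree G (clique k)) → MinDegree G (7 + e)
  minimum-degree clique-ok = every-vertex , attained (inhabited-or-empty m)
    where
    every-vertex : ∀ x → 7 + e ≤ degree G x
    every-vertex x = subst (λ y → 7 + e ≤ degree G y) (vertex-kind x) (by-kind (kind D m x))
      where
      by-kind : ∀ u → 7 + e ≤ degree G (vertex u)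
      by-kind (kv k)   = clique-ok k
      by-kind (cv j l) = copy-degree-≥ j l
    attained : Fin m ⊎ ¬ Fin m → ∃ λ x → degree G x ≡ 7 + e
    attained (inj₁ j)       = copy j (# 0) , ≤-antisym (corner-degree j) (copy-degree-≥ j (# 0))
    attained (inj₂ no-copy) =
      ⊥-elim (m+n≮n 2 (4 + e) (≤-trans (clique-ok F.zero) (clique-degree-without-copies no-copy F.zero)))

  within-neighbour : ∀ {j l y} → CopyNeighbour j l y → (∀ t → l ≡ mid t → ¬ y ≡ clique (att j t)) →
                     ∃ λ l′ → y ≡ copy j l′ × adjP l l′ ≡ true
  within-neighbour (within {l′} a)    _          = l′ , refl , a
  within-neighbour (attachment t l≡) not-attach = ⊥-elim (not-attach t l≡ refl)

  copy-cut : ∀ j x y → G x y ≡ true → in-copy j x ≡ true → in-copy j y ≡ false →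
             ∃ λ t → x ≡ copy j (mid t) × y ≡ clique (att j t)
  copy-cut j x y adj x-in y-out with in-copy⇒copy j x x-in
  ... | l , refl with copy-neighbour j l {y} adj
  ...   | within _ = ⊥-elim (true≢false (trans (sym (in-copy-copy j _)) y-out))
  ...   | attachment t refl = t , refl , refl

  module NoImmersion (K : KImmersion D G) where

    open KImmersion K
    open Immersion G G-sym K

    module CopyCut (j : Fin m) = ThreeEdgeCut (in-copy j) (λ t → copy j (mid t)) (λ t → clique (att j t)) (copy-cut j)

    module AllInCopy (j : Fin m) (all-in : ∀ p → in-copy j (φ p) ≡ true) where

      open CopyCut j

      loc : Branch → Label
      loc p = proj₁ (in-copy⇒copy j (φ p) (all-in p))

      φ≡copy : ∀ p → φ p ≡ copy j (loc p)
      φ≡copy p = proj₂ (in-copy⇒copy j (φ p) (all-in p))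

      loc-injective : ∀ {p q} → loc p ≡ loc q → p ≡ q
      loc-injective {p} {q} eq = φ-inj (trans (φ≡copy p) (trans (cong (copy j) eq) (sym (φ≡copy q))))

      branch-adjacent : ∀ p {x} → G (φ p) x ≡ true → G (copy j (loc p)) x ≡ true
      branch-adjacent p {x} = subst (λ v → G v x ≡ true) (φ≡copy p)

      -- A label is occupied if some branch vertex sits there; at most one label is free.
      Occupied : Label → Set
      Occupied l = ∃ λ p → loc p ≡ l

      occupied? : ∀ l → Dec (Occupied l)
      occupied? l = any? (λ p → loc p ≟ l)

      occupied-since : ∀ {l₁ l₂} → ¬ l₁ ≡ l₂ → ¬ Occupied l₁ → Occupied l₂
      occupied-since {l₁} {l₂} l₁≢l₂ free₁ with occupied? l₂
      ... | yes occ = occ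
      ... | no free₂ = ⊥-elim (injection-misses-one loc loc-injective l₁≢l₂
                                 (λ p eq → free₁ (p , eq)) (λ p eq → free₂ (p , eq)))

      -- A branch vertex has d - 1 link neighbours but only d neighbours in total,
      -- so it never lies inside another link.
      never-interior : ∀ p {a b} (L : Link a b) → ¬ p ≡ a → ¬ p ≡ b → φ p ∈ route L → ⊥
      never-interior p L p≢a p≢b φp∈ with interior-branch-neighbours p L p≢a p≢b φp∈
      ... | xs , uxs , adj , len =
        1+n≰n (subst (_≤ D) len (copy-neighbours-≤ j (loc p) xs uxs (λ {x} x∈ → branch-adjacent p {x} (adj x∈))))

      -- A branch vertex at a middle label uses its attachment edge: inside its copy
      -- it has only d - 2 neighbours.
      attachment-used : ∀ p t → loc p ≡ mid t → ∃ λ r → branch-neighbour p r ≡ clique (att j t)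
      attachment-used p t at-mid with any? (λ r → branch-neighbour p r ≟ clique (att j t))
      ... | yes used = used
      ... | no unused = ⊥-elim (1+n≰n (subst (_≤ 6 + e) (branch-neighbours-length p)
              (middle-inner-neighbours-≤ j t (branch-neighbours p) (branch-neighbours-unique p)
                 (λ {x} x∈ → subst (λ l → G (copy j l) x ≡ true) at-mid (branch-adjacent p {x} (branch-neighbours-adjacent p x∈)))
                 not-there)))
        where
        not-there : ¬ clique (att j t) ∈ branch-neighbours p
        not-there x∈ with ∈-map⁻ (branch-neighbour p) x∈
        ... | r , _ , eq = unused (r , sym eq)

      AttachmentLink : Branch → Fin 3 → Set
      AttachmentLink p t = ∃ λ r → branch-neighbour p r ≡ clique (att j t) × Excursion (link-to-other p r)

      attachment-excursion : ∀ p t → loc p ≡ mid t → AttachmentLink p t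
      attachment-excursion p t at-mid with attachment-used p t at-mid
      ... | r , uses = r , uses ,
        excursion (link-to-other p r) (all-in p) (all-in (other p r))
          (subst (_∈ route (link-to-other p r)) uses (FirstStep.y∈ (step-to-other p r)))
          (in-copy-clique j (att j t))

      -- If a middle branch vertex p starts its link to a branch vertex that is not
      -- its P_d-neighbour with an edge inside the copy, that edge ends at a free label:
      -- a branch vertex there would be interior to the link.
      free-beside : ∀ p t → loc p ≡ mid t → ∀ r → adjP (mid t) (loc (other p r)) ≡ false →
                    ¬ branch-neighbour p r ≡ clique (att j t) →
                    ∃ λ l → branch-neighbour p r ≡ copy j l × ¬ Occupied l
      free-beside p t at-mid r target≁ not-attachment
        with within-neighbour
               (copy-neighbour j (loc p) {branch-neighbour p r}
                  (branch-adjacent p {branch-neighbour p r} (FirstStep.adj (step-to-other p r))))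
               (λ t′ at-mid′ → subst (λ s → ¬ branch-neighbour p r ≡ clique (att j s))
                                     (mid-injective (trans (sym at-mid) at-mid′)) not-attachment)
      ... | l , y≡ , p∼l = l , y≡ , occupied-would-be-interior
        where
        occupied-would-be-interior : ¬ Occupied l
        occupied-would-be-interior (q , at-l) =
          never-interior q (link-to-other p r) q≢p q≢target
            (subst (_∈ route (link-to-other p r)) (sym φq≡y) (FirstStep.y∈ (step-to-other p r)))
          where
          φq≡y : φ q ≡ branch-neighbour p r
          φq≡y = trans (φ≡copy q) (trans (cong (copy j) at-l) (sym y≡))
          q≢p : ¬ q ≡ p
          q≢p refl = FirstStep.y≢ (step-to-other p r) φq≡y
          q≢target : ¬ q ≡ other p r
          q≢target refl = true≢false (trans (sym p∼l) (subst (λ l′ → adjP l′ l ≡ false) (sym at-mid)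
                            (subst (λ l′ → adjP (mid t) l′ ≡ false) at-l target≁)))

      -- A middle branch vertex p whose previous and next labels are occupied by a
      -- and b must send its attachment link to a or b: otherwise its links to a and b
      -- start inside the copy and reach two different free labels.
      attachment-link-to-flank : ∀ p t → loc p ≡ mid t → ∀ {a b} → loc a ≡ prev t → loc b ≡ next t →
                                 ∀ r → branch-neighbour p r ≡ clique (att j t) →
                                 ¬ other p r ≡ a → ¬ other p r ≡ b → ⊥
      attachment-link-to-flank p t at-mid {a} {b} at-prev at-next r uses r↛a r↛b =
        two-free-labels
          (free-beside p t at-mid ra (non-adjacent a p≢a (mid≁prev t) at-prev) (not-attachment a p≢a r↛a))
          (free-beside p t at-mid rb (non-adjacent b p≢b (mid≁next t) at-next) (not-attachment b p≢b r↛b))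
        where
        p≢a : ¬ p ≡ a
        p≢a refl = prev≢mid t t (trans (sym at-prev) at-mid)
        p≢b : ¬ p ≡ b
        p≢b refl = next≢mid t t (trans (sym at-next) at-mid)
        ra rb : Fin (7 + e)
        ra = punchOut p≢a
        rb = punchOut p≢b
        non-adjacent : ∀ c (p≢c : ¬ p ≡ c) {l} → adjP (mid t) l ≡ false → loc c ≡ l →
                       adjP (mid t) (loc (other p (punchOut p≢c))) ≡ false
        non-adjacent c p≢c mid≁l at-l rewrite punchIn-punchOut p≢c | at-l = mid≁l
        not-attachment : ∀ c (p≢c : ¬ p ≡ c) → ¬ other p r ≡ c →
                         ¬ branch-neighbour p (punchOut p≢c) ≡ clique (att j t)
        not-attachment c p≢c r↛c eq =
          r↛c (trans (cong (other p) (branch-neighbour-injective p (trans uses (sym eq)))) (punchIn-punchOut p≢c))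
        two-free-labels : (∃ λ l → branch-neighbour p ra ≡ copy j l × ¬ Occupied l) →
                          (∃ λ l → branch-neighbour p rb ≡ copy j l × ¬ Occupied l) → ⊥
        two-free-labels (la , ya≡ , free-a) (lb , yb≡ , free-b) =
          injection-misses-one loc loc-injective la≢lb (λ q eq → free-a (q , eq)) (λ q eq → free-b (q , eq))
          where
          la≢lb : ¬ la ≡ lb
          la≢lb la≡lb = prev≢next t t (trans (sym at-prev) (trans (cong loc a≡b) at-next))
            where
            a≡b : a ≡ b
            a≡b = trans (sym (punchIn-punchOut p≢a))
                    (trans (cong (other p)
                             (branch-neighbour-injective p (trans ya≡ (trans (cong (copy j) la≡lb) (sym yb≡)))))
                           (punchIn-punchOut p≢b))

      -- Two occupied middle labels t ≠ s are impossible (u is the third label):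
      -- their attachment links are excursions, so they must be the same link,
      -- joining the two middle branch vertices; then the third middle label is
      -- either occupied, giving a third excursion, or free, so that both flanks
      -- of t are occupied and the attachment link of t avoids them.
      two-middles : ∀ {t s u} → ¬ t ≡ s → ¬ t ≡ u → ¬ s ≡ u →
                    Occupied (mid t) → Occupied (mid s) → Dec (Occupied (mid u)) → ⊥
      two-middles {t} {s} {u} t≢s t≢u s≢u (pt , at-t) (ps , at-s) u? =
        compare (attachment-excursion pt t at-t) (attachment-excursion ps s at-s)
        where
        compare : AttachmentLink pt t → AttachmentLink ps s → ⊥
        compare (rt , uses-t , Xt) (rs , _ , Xs) = by-pairs (same-pair? pt (other pt rt) ps (other ps rs))
          where
          by-pairs : Dec (SamePair pt (other pt rt) ps (other ps rs)) → ⊥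
          by-pairs (no distinct)             = no-two-excursions (link-to-other pt rt) (link-to-other ps rs) distinct Xt Xs
          by-pairs (yes (inj₁ (pt≡ps , _))) = t≢s (mid-injective (trans (sym at-t) (trans (cong loc pt≡ps) at-s)))
          by-pairs (yes (inj₂ (_ , t→s)))   = third u?
            where
            third : Dec (Occupied (mid u)) → ⊥
            third (yes (pu , at-u)) = third-link (attachment-excursion pu u at-u)
              where
              third-link : AttachmentLink pu u → ⊥
              third-link (ru , _ , Xu) = no-two-excursions (link-to-other pt rt) (link-to-other pu ru) distinct Xt Xu
                where
                distinct : ¬ SamePair pt (other pt rt) pu (other pu ru)
                distinct (inj₁ (pt≡pu , _)) = t≢u (mid-injective (trans (sym at-t) (trans (cong loc pt≡pu) at-u)))
                distinct (inj₂ (_ , t→u))   =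
                  s≢u (mid-injective (trans (sym at-s) (trans (cong loc (trans (sym t→s) t→u)) at-u)))
            third (no free-u) = flanked (occupied-since (λ eq → prev≢mid t u (sym eq)) free-u)
                                        (occupied-since (λ eq → next≢mid t u (sym eq)) free-u)
              where
              flanked : Occupied (prev t) → Occupied (next t) → ⊥
              flanked (a , at-prev) (b , at-next) =
                attachment-link-to-flank pt t at-t at-prev at-next rt uses-t
                  (λ t→a → prev≢mid t s (trans (sym at-prev) (trans (cong loc (trans (sym t→a) t→s)) at-s)))
                  (λ t→b → next≢mid t s (trans (sym at-next) (trans (cong loc (trans (sym t→b) t→s)) at-s)))

      -- Among the three middle labels at most one is free.
      impossible : ⊥
      impossible with occupied? (mid path₀) | occupied? (mid path₁)
      ... | yes o₀ | yes o₁ = two-middles {path₀} {path₁} {path₂} (λ ()) (λ ()) (λ ()) o₀ o₁ (occupied? (mid path₂))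
      ... | yes o₀ | no f₁  = two-middles {path₀} {path₂} {path₁} (λ ()) (λ ()) (λ ()) o₀ (occupied-since (λ ()) f₁) (no f₁)
      ... | no f₀  | _      = two-middles {path₁} {path₂} {path₀} (λ ()) (λ ()) (λ ())
                                (occupied-since (λ ()) f₀) (occupied-since (λ ()) f₀) (no f₀)

    -- Some branch vertex lies in a copy, so all do (the copy is cut off by three
    -- edges), which is impossible; or all d branch vertices lie in the clique
    -- K_(d-3), which is too small.
    no-immersion : ⊥
    no-immersion with any? (λ p → any? (λ j → in-copy j (φ p) Bool.≟ true))
    ... | yes (p₀ , j , p₀-in) =
      AllInCopy.impossible j (CopyCut.all-inside j (s≤s (s≤s (s≤s (s≤s z≤n)))) p₀-in)
    ... | no none = m+n≮n 2 (5 + e) (injective⇒≤ index-injective)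
      where
      as-clique : ∀ p → ∃ λ k → φ p ≡ clique k
      as-clique p = clique-vertex (φ p) (λ j p-in → none (p , j , p-in))
      index-injective : ∀ {p q} → proj₁ (as-clique p) ≡ proj₁ (as-clique q) → p ≡ q
      index-injective {p} {q} eq =
        φ-inj (trans (proj₂ (as-clique p)) (trans (cong clique eq) (sym (proj₂ (as-clique q)))))

theorem4p9 : (d m : ℕ) → 8 ≤ d →
    (att : Fin m → Fin 3 → Fin (d ∸ 3)) →
    (∀ k → d ∸ 1 ≤ degree (Gd d m att) (kVertex d m k)) →
    MinDegree (Gd d m att) (d ∸ 1) × ¬ KImmersion d (Gd d m att)
theorem4p9 _ m (s≤s (s≤s (s≤s (s≤s (s≤s (s≤s (s≤s (s≤s (z≤n {e}))))))))) att clique-ok =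
  minimum-degree clique-ok , NoImmersion.no-immersion
  where open GdFacts e m att
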